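{- Fix a class of monadic second-order structures in which $m$ is the maximal arity of relations. For every $d\in\{0,1,\dots\}$, the following three functions, each mapping a structure $\mathfrak A$ of the class together with a subset $X$ of its universe to a natural number, are pairwise asymptotically equivalent: (1) the number of distinct rows of $M_{0,m}$; (2) the number of distinct rows of $M_{0,d+m}$; (3) the number of distinct rows of $M_{d,m}$.
   Context: A monadic second-order structure is a finite universe with relations all of whose arguments are subsets of the universe (an $n$-ary relation is a set of $n$-tuples of subsets). The $d$-type of a tuple of subsets is the set of MSO formulas of quantifier depth at most $d$ with the corresponding free set variables that hold for the tuple ($d=0$ giving the quantifier-free type). For a structure $\mathfrak A$, a subset $X$ of its universe and $d,n\ge0$, the matrix $M_{d,n}$ has rows indexed by $n$-tuples $(X_1,\dots,X_n)$ of subsets of $X$, columns indexed by $n$-tuples $(Y_1,\dots,Y_n)$ of subsets of the complement of $X$, and entry the $d$-type of $(X_1\cup Y_1,\dots,X_n\cup Y_n)$ in $\mathfrak A$. Two functions $\mu_1,\mu_2:D\to\mathbb N$ are asymptotically equivalent if for every $Y\subseteq D$, $\mu_1$ is bounded on $Y$ iff $\mu_2$ is bounded on $Y$. -}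

module Defs where

open import Data.Nat using (ℕ; zero; suc; _≤_; _⊔_)
open import Data.Fin using (Fin)
open import Data.Bool using (Bool; T)
open import Data.Vec using (Vec; []; _∷_; lookup; map; zipWith; tabulate; foldr′)
open import Data.Vec.Relation.Unary.All using (All)
open import Data.Fin.Subset using (Subset; _⊆_; _∪_; ∁)
open import Data.Product using (Σ; ∃; _×_; _,_)
open import Relation.Binary.PropositionalEquality using (_≢_)
open import Relation.Nullary using (¬_)
open import Function.Bundles using (_⇔_)

record Signature : Set where
  field
    nrel  : ℕ
    arity : Fin nrel → ℕ
open Signature public

maxArity : Signature → ℕ
maxArity S = foldr′ _⊔_ 0 (tabulate (arity S))

-- A monadic second-order structure: finite universe Fin size; each relation
-- is a set of tuples of subsets of the universe (given by its characteristic function).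
record Structure (S : Signature) : Set where
  field
    size : ℕ
    rel  : (i : Fin (nrel S)) → Vec (Subset size) (arity S i) → Bool
open Structure public

-- MSO formulas with v free set variables (de Bruijn; variable 0 is the most recently bound).
data Formula (S : Signature) (v : ℕ) : Set where
  atom : (i : Fin (nrel S)) → Vec (Fin v) (arity S i) → Formula S v
  incl : Fin v → Fin v → Formula S v
  neg  : Formula S v → Formula S v
  conj : Formula S v → Formula S v → Formula S v
  ex   : Formula S (suc v) → Formula S v

qd : ∀ {S v} → Formula S v → ℕ
qd (atom i xs) = 0
qd (incl x y)  = 0
qd (neg φ)     = qd φ
qd (conj φ ψ)  = qd φ ⊔ qd ψ
qd (ex φ)      = suc (qd φ)

Sat : ∀ {S v} (A : Structure S) → Formula S v → Vec (Subset (size A)) v → Set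
Sat A (atom i xs) t = T (rel A i (map (lookup t) xs))
Sat A (incl x y)  t = lookup t x ⊆ lookup t y
Sat A (neg φ)     t = ¬ Sat A φ t
Sat A (conj φ ψ)  t = Sat A φ t × Sat A ψ t
Sat A (ex φ)      t = Σ (Subset (size A)) λ Z → Sat A φ (Z ∷ t)

SameType : ∀ {S} (A : Structure S) (d : ℕ) {n : ℕ} → (t t' : Vec (Subset (size A)) n) → Set
SameType {S} A d {n} t t' = (φ : Formula S n) → qd φ ≤ d → Sat A φ t ⇔ Sat A φ t'

-- row indices of M_{d,n}: n-tuples of subsets of X
Row : ∀ {S} (A : Structure S) (X : Subset (size A)) (n : ℕ) → Set
Row A X n = Σ (Vec (Subset (size A)) n) (All (_⊆ X))

-- equality of two rows of M_{d,n}: equal d-type entries in every column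
-- (columns = n-tuples of subsets of the complement of X)
RowEq : ∀ {S} (A : Structure S) (X : Subset (size A)) (d n : ℕ) → Row A X n → Row A X n → Set
RowEq A X d n (r , _) (r' , _) =
  (c : Vec (Subset (size A)) n) → All (_⊆ ∁ X) c →
  SameType A d (zipWith _∪_ r c) (zipWith _∪_ r' c)

-- "the number of distinct rows of M_{d,n} is at most B":
-- there are no B+1 pairwise distinct rows.
RowsAtMost : ∀ {S} (A : Structure S) (X : Subset (size A)) (d n B : ℕ) → Set
RowsAtMost A X d n B =
  (f : Fin (suc B) → Row A X n) →
  ¬ (∀ i j → i ≢ j → ¬ RowEq A X d n (f i) (f j))

Dom : ∀ {S} → (Structure S → Set) → Set
Dom {S} C = Σ (Structure S) λ A → C A × Subset (size A)

-- a function μ : Dom C → ℕ presented by its "μ(x) ≤ B" predicate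
-- (number-of-distinct-rows functions); boundedness on Y
BoundedOn : ∀ {S} {C : Structure S → Set} → (Dom C → Set) → (Dom C → ℕ → Set) → Set
BoundedOn {C = C} Y μ≤ = ∃ λ B → (x : Dom C) → Y x → μ≤ x B

AsympEquiv : ∀ {S} (C : Structure S → Set) → (Dom C → ℕ → Set) → (Dom C → ℕ → Set) → Set₁
AsympEquiv C μ₁≤ μ₂≤ = (Y : Dom C → Set) → BoundedOn Y μ₁≤ ⇔ BoundedOn Y μ₂≤

numRows≤ : ∀ {S} (C : Structure S → Set) (d n : ℕ) → Dom C → ℕ → Set
numRows≤ C d n (A , _ , X) B = RowsAtMost A X d n B

-- A quantifier-free type is fixed by its atoms, each of which involves at most m coordinates,
-- and by the inclusions between coordinates. With X-parts and column parts living on disjoint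
-- sets, an inclusion between unions splits into one inside X and one outside, so the row of an
-- l-tuple in M_{0,l} is determined by the rows of its projections to m coordinates together
-- with the inclusion pattern of the tuple: B rows for M_{0,m} give at most B^(l^m) 2^(l²) rows.
-- For depth d one plays an Ehrenfeucht–Fraïssé game on the X-parts only: a set witness W splits
-- into W ∩ X, answered in the game, and W ∩ ∁X, absorbed into the column. Classifying rows by
-- their 0-row and by the classes reached by their one-set extensions bounds the rows of M_{d,m}
-- by a tower in B. The converse bounds are immediate: padding with empty sets embeds the rows
-- of M_{0,m} into M_{0,d+m}, and d-types refine 0-types.
-- Counting is done classically under double negation, which suffices since "at most B rows"
-- is a negative statement.
module Submission where

open import Defs
open import Level using (0ℓ)
open import Data.Nat using (ℕ; zero; suc; _+_; _*_; _^_; _≤_; _⊔_; z≤n; s≤s)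
open import Data.Nat.Properties
  using ( ≤-trans; n<1+n; suc-injective; m≤n+m; +-suc; +-identityʳ
        ; m≤m⊔n; m≤n⇒m≤o⊔n; m⊔n≤o⇒m≤o; m⊔n≤o⇒n≤o)
open import Data.Fin
  using (Fin; zero; suc; inject≤; combine; remQuot; _↑ʳ_; lift; finToFun; funToFin)
open import Data.Fin.Properties
  using (pigeonhole; <⇒≢; inject≤-injective; remQuot-combine; finToFun-funToFin)
open import Data.Fin.Subset using (Subset; _⊆_; _∪_; _∩_; ∁; _∈_) renaming (⊥ to ∅; ⊤ to full)
open import Data.Fin.Subset.Properties
  using ( _⊆?_; anySubset?; ⊆-min; x∈p∩q⁻; x∈p∪q⁻; x∈p∪q⁺; x∈∁p⇒x∉p
        ; p∪∁p≡⊤; ∩-identityʳ; ∩-distribˡ-∪)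
open import Data.Bool using (T)
open import Data.Vec using (Vec; []; _∷_; lookup; map; zipWith; tabulate; replicate; foldr′; _++_)
open import Data.Vec.Properties
  using (lookup-zipWith; lookup∘tabulate; tabulate-cong; map-∘; map-cong; zipWith-++; lookup-++ʳ)
import Data.Vec.Functional as Vector
open import Data.Vec.Relation.Unary.All using (All; []; _∷_)
open import Data.Vec.Relation.Unary.All.Properties using (lookup⁺; tabulate⁺; ++⁺)
open import Data.Product using (Σ; ∃; _×_; _,_; proj₁; proj₂)
open import Data.Product.Function.NonDependent.Propositional using (_×-⇔_)
open import Data.Sum using (inj₁; inj₂; [_,_]′)
import Data.Sum as Sum
open import Data.Empty using (⊥-elim)
open import Data.Unit using (⊤; tt)
open import Function using (_∘_; id; const)
open import Function.Bundles using (_⇔_; mk⇔; Equivalence)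
open import Function.Properties.Equivalence
  using (⇔-setoid; ⇔-isEquivalence) renaming (refl to ⇔-refl; sym to ⇔-sym; trans to ⇔-trans)
open import Function.Related.TypeIsomorphisms using (¬-cong-⇔)
open import Relation.Binary.Structures using (IsEquivalence)
open import Relation.Binary.Definitions using (Symmetric; Transitive)
open import Relation.Binary.PropositionalEquality
open import Relation.Nullary using (¬_; Dec; yes; no; ¬?; _×-dec_)
open import Relation.Nullary.Decidable using (T?; decidable-stable; ¬¬-excluded-middle)
open import Relation.Nullary.Negation using (¬¬-map; ¬¬-Monad)
open import Effect.Monad using (RawMonad)
import Relation.Binary.Reasoning.Setoid as SetoidReasoning

open IsEquivalence (⇔-isEquivalence {0ℓ}) using () renaming (reflexive to ⇔-reflexive)

private
  variable
    U V : Set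
    j k m n K K₁ K₂ B : ℕ

¬¬-∀-Fin : {P : Fin n → Set} → (∀ i → ¬ ¬ P i) → ¬ ¬ (∀ i → P i)
¬¬-∀-Fin {zero}  h k = k (λ ())
¬¬-∀-Fin {suc n} h k =
  h zero λ p₀ → ¬¬-∀-Fin (h ∘ suc) λ ps → k λ { zero → p₀ ; (suc i) → ps i }

Distinct : (U → U → Set) → (Fin k → U) → Set
Distinct R g = ∀ i j → i ≢ j → ¬ R (g i) (g j)

AtMostClasses : (U → U → Set) → ℕ → Set
AtMostClasses {U} R B = (g : Fin (suc B) → U) → ¬ Distinct R g

-- Membership in a class is only ¬¬-decided: the relations of interest quantify over all
-- formulas.
record Cover {U : Set} (R : U → U → Set) (K : ℕ) : Set₁ where
  field
    Class    : U → Fin K → Set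
    classify : ∀ t → ¬ ¬ ∃ (Class t)
    related  : ∀ {t t′ c} → Class t c → Class t′ c → R t t′

module _ {R : U → U → Set} where

  ¬¬Cover⇒AtMostClasses : ¬ ¬ Cover R K → AtMostClasses R K
  ¬¬Cover⇒AtMostClasses {K} ¬¬cover g distinct = ¬¬cover λ cover →
    let open Cover cover in
    ¬¬-∀-Fin (classify ∘ g) λ classes →
      let (i , j , i<j , same) = pigeonhole (n<1+n K) (proj₁ ∘ classes) in
      distinct i j (<⇒≢ i<j)
        (related (proj₂ (classes i)) (subst (Class (g j)) (sym same) (proj₂ (classes j))))

  module _ (R-sym : Symmetric R) (R-trans : Transitive R) where

    maximal⇒Cover : j ≤ K → (g : Fin j → U) → ¬ (∃ λ t → ∀ i → ¬ R t (g i)) → Cover R K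
    maximal⇒Cover j≤K g maximal = record
      { Class    = λ t c → ∃ λ i → inject≤ i j≤K ≡ c × R t (g i)
      ; classify = λ t k → maximal (t , λ i r → k (inject≤ i j≤K , i , refl , r))
      ; related  = λ { (i , refl , r) (i′ , i′≡i , r′) →
          R-trans r (R-sym (subst (R _ ∘ g) (inject≤-injective j≤K j≤K i′ i i′≡i) r′)) }
      }

    Distinct-∷ : ∀ {t} {g : Fin k → U} → (∀ i → ¬ R t (g i)) → Distinct R g →
                 Distinct R (t Vector.∷ g)
    Distinct-∷ new distinct zero    zero    0≢0 = λ _ → 0≢0 refl
    Distinct-∷ new distinct zero    (suc j) _   = new j
    Distinct-∷ new distinct (suc i) zero    _   = new i ∘ R-sym
    Distinct-∷ new distinct (suc i) (suc j) i≢j = distinct i j (i≢j ∘ cong suc)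

    -- Classically: extend a distinct family until it is maximal; AtMostClasses stops
    -- the growth after K elements, and the members of a maximal family represent the classes.
    AtMostClasses⇒¬¬Cover : AtMostClasses R K → ¬ ¬ Cover R K
    AtMostClasses⇒¬¬Cover {K} atMost = grow K (+-identityʳ K) (λ ()) (λ ())
      where
      extend : ∀ r → r + suc j ≡ suc K → (g : Fin (suc j) → U) → Distinct R g → ¬ ¬ Cover R K
      grow : ∀ r → r + j ≡ K → (g : Fin j → U) → Distinct R g → ¬ ¬ Cover R K
      grow {j} r r+j≡K g distinct k = ¬¬-excluded-middle λ where
        (no maximal)    → k (maximal⇒Cover (subst (j ≤_) r+j≡K (m≤n+m j r)) g maximal)
        (yes (t , new)) →
          extend r (trans (+-suc r j) (cong suc r+j≡K)) (t Vector.∷ g) (Distinct-∷ new distinct) k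
      extend zero    refl      g distinct _ = atMost g distinct
      extend (suc r) r+1+j≡1+K g distinct   = grow r (suc-injective r+1+j≡1+K) g distinct

AtMostClasses-reflect : {R : U → U → Set} {S : V → V → Set} {B : ℕ} (f : U → V) →
                        (∀ {a b} → S (f a) (f b) → R a b) → AtMostClasses S B → AtMostClasses R B
AtMostClasses-reflect f reflect atMost g distinct =
  atMost (f ∘ g) λ i j i≢j → distinct i j i≢j ∘ reflect

module _ {R R′ : U → U → Set} where

  Cover-weaken : (∀ {a b} → R a b → R′ a b) → Cover R K → Cover R′ K
  Cover-weaken R⇒R′ cover = record { Cover cover; related = λ x y → R⇒R′ (related x y) }
    where open Cover cover

  Cover-× : Cover R K₁ → Cover R′ K₂ → Cover (λ a b → R a b × R′ a b) (K₁ * K₂)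
  Cover-× {K₂ = K₂} cover cover′ = record
    { Class    = λ t c → Both t (remQuot K₂ c)
    ; classify = λ t → do
        (c₁ , x₁) ← C.classify t
        (c₂ , x₂) ← C′.classify t
        return (combine c₁ c₂ , subst (Both t) (sym (remQuot-combine c₁ c₂)) (x₁ , x₂))
    ; related  = λ (x₁ , x₂) (y₁ , y₂) → C.related x₁ y₁ , C′.related x₂ y₂
    }
    where
    module C = Cover cover
    module C′ = Cover cover′
    open RawMonad (¬¬-Monad {0ℓ})
    Both : U → Fin _ × Fin K₂ → Set
    Both t (c₁ , c₂) = C.Class t c₁ × C′.Class t c₂

Cover-comap : {R : U → U → Set} (f : V → U) → Cover R K → Cover (λ a b → R (f a) (f b)) K
Cover-comap f cover = record
  { Class = Class ∘ f ; classify = classify ∘ f ; related = related }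
  where open Cover cover

Cover-Π : ∀ r {R : Fin r → U → U → Set} → (∀ i → Cover (R i) K) →
          Cover (λ a b → ∀ i → R i a b) (K ^ r)
Cover-Π zero    covers = record
  { Class = λ _ _ → ⊤ ; classify = λ _ k → k (zero , tt) ; related = λ _ _ () }
Cover-Π (suc r) covers = Cover-weaken (λ (head , tail) → λ { zero → head ; (suc i) → tail i })
                                       (Cover-× (covers zero) (Cover-Π r (covers ∘ suc)))

Cover-⇔ : (P : U → Set) → Cover (λ a b → P a ⇔ P b) 2
Cover-⇔ P = record
  { Class    = λ t c → P t ⇔ (c ≡ zero)
  ; classify = λ t k → ¬¬-excluded-middle λ where
      (yes p)  → k (zero , mk⇔ (const refl) (const p))
      (no ¬p)  → k (suc zero , mk⇔ (⊥-elim ∘ ¬p) λ ())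
  ; related  = λ x y → ⇔-trans x (⇔-sym y)
  }

arity≤maxArity : (S : Signature) (i : Fin (nrel S)) → arity S i ≤ maxArity S
arity≤maxArity S i =
  subst (_≤ maxArity S) (lookup∘tabulate (arity S) i) (lookup≤foldr⊔ (tabulate (arity S)) i)
  where
  lookup≤foldr⊔ : (v : Vec ℕ n) (i : Fin n) → lookup v i ≤ foldr′ _⊔_ 0 v
  lookup≤foldr⊔ (x ∷ v) zero    = m≤m⊔n x _
  lookup≤foldr⊔ (x ∷ v) (suc i) = m≤n⇒m≤o⊔n x (lookup≤foldr⊔ v i)

module _ {S : Signature} where

  rename : (Fin m → Fin n) → Formula S m → Formula S n
  rename ρ (atom i xs) = atom i (map ρ xs)
  rename ρ (incl x y)  = incl (ρ x) (ρ y)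
  rename ρ (neg φ)     = neg (rename ρ φ)
  rename ρ (conj φ ψ)  = conj (rename ρ φ) (rename ρ ψ)
  rename ρ (ex φ)      = ex (rename (lift 1 ρ) φ)

  qd-rename : (ρ : Fin m → Fin n) (φ : Formula S m) → qd (rename ρ φ) ≡ qd φ
  qd-rename ρ (atom i xs) = refl
  qd-rename ρ (incl x y)  = refl
  qd-rename ρ (neg φ)     = qd-rename ρ φ
  qd-rename ρ (conj φ ψ)  = cong₂ _⊔_ (qd-rename ρ φ) (qd-rename ρ ψ)
  qd-rename ρ (ex φ)      = cong suc (qd-rename (lift 1 ρ) φ)

  module _ (A : Structure S) where

    Sat? : (φ : Formula S n) (t : Vec (Subset (size A)) n) → Dec (Sat A φ t)
    Sat? (atom i xs) t = T? _
    Sat? (incl x y)  t = lookup t x ⊆? lookup t y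
    Sat? (neg φ)     t = ¬? (Sat? φ t)
    Sat? (conj φ ψ)  t = Sat? φ t ×-dec Sat? ψ t
    Sat? (ex φ)      t = anySubset? λ Z → Sat? φ (Z ∷ t)

    Sat-rename : (ρ : Fin m → Fin n) (φ : Formula S m) (t : Vec _ n) (t′ : Vec _ m) →
                 (∀ i → lookup t′ i ≡ lookup t (ρ i)) → Sat A (rename ρ φ) t ⇔ Sat A φ t′
    Sat-rename ρ (atom i xs) t t′ t′≗t∘ρ =
      ⇔-reflexive (cong (T ∘ rel A i)
                        (trans (sym (map-∘ (lookup t) ρ xs)) (map-cong (sym ∘ t′≗t∘ρ) xs)))
    Sat-rename ρ (incl x y) t t′ t′≗t∘ρ rewrite t′≗t∘ρ x | t′≗t∘ρ y = ⇔-refl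
    Sat-rename ρ (neg φ)    t t′ t′≗t∘ρ = ¬-cong-⇔ (Sat-rename ρ φ t t′ t′≗t∘ρ)
    Sat-rename ρ (conj φ ψ) t t′ t′≗t∘ρ = Sat-rename ρ φ t t′ t′≗t∘ρ ×-⇔ Sat-rename ρ ψ t t′ t′≗t∘ρ
    Sat-rename ρ (ex φ)     t t′ t′≗t∘ρ = mk⇔
      (λ (Z , s) → Z , Equivalence.to   (Sat-rename (lift 1 ρ) φ (Z ∷ t) (Z ∷ t′) (lifted Z)) s)
      (λ (Z , s) → Z , Equivalence.from (Sat-rename (lift 1 ρ) φ (Z ∷ t) (Z ∷ t′) (lifted Z)) s)
      where
      lifted : ∀ Z i → lookup (Z ∷ t′) i ≡ lookup (Z ∷ t) (lift 1 ρ i)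
      lifted Z zero    = refl
      lifted Z (suc i) = t′≗t∘ρ i

module ⇔-Reasoning = SetoidReasoning (⇔-setoid 0ℓ)

∩-∁-split : (W Y : Subset n) → W ≡ W ∩ Y ∪ W ∩ ∁ Y
∩-∁-split W Y = begin
  W                ≡⟨ ∩-identityʳ W ⟨
  W ∩ full         ≡⟨ cong (W ∩_) (p∪∁p≡⊤ Y) ⟨
  W ∩ (Y ∪ ∁ Y)    ≡⟨ ∩-distribˡ-∪ W Y (∁ Y) ⟩
  W ∩ Y ∪ W ∩ ∁ Y  ∎
  where open ≡-Reasoning

∪-⊆-∪⇔ : {P P′ Q Q′ Y : Subset n} → P ⊆ Y → P′ ⊆ Y → Q ⊆ ∁ Y → Q′ ⊆ ∁ Y →
         (P ∪ Q ⊆ P′ ∪ Q′) ⇔ (P ⊆ P′ × Q ⊆ Q′)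
∪-⊆-∪⇔ {P = P} {P′} {Q} {Q′} {Y} P⊆Y P′⊆Y Q⊆∁Y Q′⊆∁Y = mk⇔ to from
  where
  inY⇒inP′ : ∀ {x} → x ∈ Y → x ∈ P′ ∪ Q′ → x ∈ P′
  inY⇒inP′ x∈Y x∈ = [ id , (λ x∈Q′ → ⊥-elim (x∈∁p⇒x∉p (Q′⊆∁Y x∈Q′) x∈Y)) ]′ (x∈p∪q⁻ P′ Q′ x∈)
  in∁Y⇒inQ′ : ∀ {x} → x ∈ ∁ Y → x ∈ P′ ∪ Q′ → x ∈ Q′
  in∁Y⇒inQ′ x∈∁Y x∈ = [ (λ x∈P′ → ⊥-elim (x∈∁p⇒x∉p x∈∁Y (P′⊆Y x∈P′))) , id ]′ (x∈p∪q⁻ P′ Q′ x∈)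
  to : P ∪ Q ⊆ P′ ∪ Q′ → P ⊆ P′ × Q ⊆ Q′
  to sub = (λ x∈P → inY⇒inP′ (P⊆Y x∈P) (sub (x∈p∪q⁺ (inj₁ x∈P))))
         , (λ x∈Q → in∁Y⇒inQ′ (Q⊆∁Y x∈Q) (sub (x∈p∪q⁺ (inj₂ x∈Q))))
  from : P ⊆ P′ × Q ⊆ Q′ → P ∪ Q ⊆ P′ ∪ Q′
  from (P⊆P′ , Q⊆Q′) x∈P∪Q = x∈p∪q⁺ (Sum.map P⊆P′ Q⊆Q′ (x∈p∪q⁻ P Q x∈P∪Q))

replicate-∅⊆ : ∀ j {Y : Subset n} → All (_⊆ Y) (replicate j ∅)
replicate-∅⊆ zero    = []
replicate-∅⊆ (suc j) = ⊆-min _ ∷ replicate-∅⊆ j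

project : (Fin m → Fin n) → Vec U n → Vec U m
project ρ t = tabulate (lookup t ∘ ρ)

project-cong : {ρ ρ′ : Fin m → Fin n} → ρ ≗ ρ′ → (t : Vec U n) → project ρ t ≡ project ρ′ t
project-cong ρ≗ρ′ t = tabulate-cong (cong (lookup t) ∘ ρ≗ρ′)

lookup-zipWith-project : (f : U → U → U) (ρ : Fin m → Fin n) (a c : Vec U n) (q : Fin m) →
                         lookup (zipWith f (project ρ a) (project ρ c)) q
                         ≡ lookup (zipWith f a c) (ρ q)
lookup-zipWith-project f ρ a c q = begin
  lookup (zipWith f ρa ρc) q        ≡⟨ lookup-zipWith f q ρa ρc ⟩
  f (lookup ρa q) (lookup ρc q)     ≡⟨ cong₂ f (lookup∘tabulate _ q) (lookup∘tabulate _ q) ⟩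
  f (lookup a (ρ q)) (lookup c (ρ q)) ≡⟨ lookup-zipWith f (ρ q) a c ⟨
  lookup (zipWith f a c) (ρ q)      ∎
  where
  open ≡-Reasoning
  ρa = project ρ a
  ρc = project ρ c

padTo : k ≤ m → U → Vec U k → Vec U m
padTo {m = m} _       u []       = replicate m u
padTo         (s≤s k≤m) u (x ∷ xs) = x ∷ padTo k≤m u xs

firstPositions : k ≤ m → Vec (Fin m) k
firstPositions z≤n       = []
firstPositions (s≤s k≤m) = zero ∷ map suc (firstPositions k≤m)

map-lookup-padTo : (k≤m : k ≤ m) (u : U) (xs : Vec U k) →
                   map (lookup (padTo k≤m u xs)) (firstPositions k≤m) ≡ xs
map-lookup-padTo z≤n       u []       = refl
map-lookup-padTo (s≤s k≤m) u (x ∷ xs) = cong (x ∷_) (begin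
  map (lookup (x ∷ padTo k≤m u xs)) (map suc (firstPositions k≤m))  ≡⟨ map-∘ _ suc _ ⟨
  map (lookup (padTo k≤m u xs)) (firstPositions k≤m)                ≡⟨ map-lookup-padTo k≤m u xs ⟩
  xs                                                                ∎)
  where open ≡-Reasoning

-- one of B classes for each projection Fin m → Fin l, and one bit per pair of coordinates
rowBound : (m B l : ℕ) → ℕ
rowBound m B l = B ^ (l ^ m) * 2 ^ (l * l)

towerBound : (ℕ → ℕ) → ℕ → ℕ → ℕ
towerBound b zero    l = b l
towerBound b (suc k) l = b l * 2 ^ towerBound b k (suc l)

module _ {S : Signature} (A : Structure S) (X : Subset (size A)) where

  private
    Sub = Subset (size A)
    M   = maxArity S

  infixr 5 _∪ᵥ_
  _∪ᵥ_ : Vec Sub n → Vec Sub n → Vec Sub n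
  _∪ᵥ_ = zipWith _∪_

  -- RowEq A X d n a b unfolds to Agree d (proj₁ a) (proj₁ b).
  Agree : ℕ → Vec Sub n → Vec Sub n → Set
  Agree d r r′ = (c : Vec Sub _) → All (_⊆ ∁ X) c → SameType A d (r ∪ᵥ c) (r′ ∪ᵥ c)

  Agree-sym : ∀ {d} {r r′ : Vec Sub n} → Agree d r r′ → Agree d r′ r
  Agree-sym agree c c⊆∁X φ qd≤d = ⇔-sym (agree c c⊆∁X φ qd≤d)

  Agree-trans : ∀ {d} {r r′ r″ : Vec Sub n} → Agree d r r′ → Agree d r′ r″ → Agree d r r″
  Agree-trans agree agree′ c c⊆∁X φ qd≤d = ⇔-trans (agree c c⊆∁X φ qd≤d) (agree′ c c⊆∁X φ qd≤d)

  Agree-mono : ∀ {d d′} {r r′ : Vec Sub n} → d ≤ d′ → Agree d′ r r′ → Agree d r r′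
  Agree-mono d≤d′ agree c c⊆∁X φ qd≤d = agree c c⊆∁X φ (≤-trans qd≤d d≤d′)

  Agree-dropPrefix : ∀ {d} {a b : Vec Sub n} (p q : Vec Sub j) → All (_⊆ ∁ X) q →
                     Agree d (p ++ a) (p ++ b) → Agree d a b
  Agree-dropPrefix {j = j} {d} {a} {b} p q q⊆∁X agree c c⊆∁X φ qd≤d = begin
    Sat A φ (a ∪ᵥ c)                         ≈⟨ Sat-rename A (j ↑ʳ_) φ _ _ (lookup-prefix a) ⟨
    Sat A φ′ ((p ++ a) ∪ᵥ (q ++ c))          ≈⟨ agree (q ++ c) (++⁺ q⊆∁X c⊆∁X) φ′ qd-φ′≤d ⟩
    Sat A φ′ ((p ++ b) ∪ᵥ (q ++ c))          ≈⟨ Sat-rename A (j ↑ʳ_) φ _ _ (lookup-prefix b) ⟩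
    Sat A φ (b ∪ᵥ c)                         ∎
    where
    open ⇔-Reasoning
    φ′ = rename (j ↑ʳ_) φ
    qd-φ′≤d : qd φ′ ≤ d
    qd-φ′≤d = subst (_≤ d) (sym (qd-rename (j ↑ʳ_) φ)) qd≤d
    lookup-prefix : ∀ r i → lookup (r ∪ᵥ c) i ≡ lookup ((p ++ r) ∪ᵥ (q ++ c)) (j ↑ʳ i)
    lookup-prefix r i = sym (trans (cong (λ v → lookup v (j ↑ʳ i)) (zipWith-++ _∪_ p r q c))
                                   (lookup-++ʳ (p ∪ᵥ q) (r ∪ᵥ c) i))

  SameProjections : Vec Sub n → Vec Sub n → Set
  SameProjections a b = (ρ : Fin M → Fin _) → Agree 0 (project ρ a) (project ρ b)

  Inclusion : Vec Sub n → Fin n × Fin n → Set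
  Inclusion a (x , y) = lookup a x ⊆ lookup a y

  SameInclusions : Vec Sub n → Vec Sub n → Set
  SameInclusions a b = ∀ p → Inclusion a p ⇔ Inclusion b p

  -- The projection is padded with a default coordinate, whence the separate case n = 0.
  atom-determined : {a b c : Vec Sub n} → SameProjections a b → All (_⊆ ∁ X) c →
                    (i : Fin (nrel S)) (xs : Vec (Fin n) (arity S i)) →
                    Sat A (atom i xs) (a ∪ᵥ c) ⇔ Sat A (atom i xs) (b ∪ᵥ c)
  atom-determined {a = []} {[]} _ _ _ _ = ⇔-refl
  atom-determined {a = a@(_ ∷ _)} {b} {c} sameProj c⊆∁X i xs =
    subst (λ zs → Sat A (atom i zs) (a ∪ᵥ c) ⇔ Sat A (atom i zs) (b ∪ᵥ c))
          (map-lookup-padTo k≤M zero xs)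
          (begin
      Sat A (rename ρ φ) (a ∪ᵥ c)           ≈⟨ via-ρ a ⟩
      Sat A φ (project ρ a ∪ᵥ project ρ c)  ≈⟨ sameProj ρ (project ρ c) ρc⊆∁X φ z≤n ⟩
      Sat A φ (project ρ b ∪ᵥ project ρ c)  ≈⟨ via-ρ b ⟨
      Sat A (rename ρ φ) (b ∪ᵥ c)           ∎)
    where
    open ⇔-Reasoning
    k≤M = arity≤maxArity S i
    ρ   = lookup (padTo k≤M zero xs)
    φ   = atom i (firstPositions k≤M)
    ρc⊆∁X : All (_⊆ ∁ X) (project ρ c)
    ρc⊆∁X = tabulate⁺ (lookup⁺ c⊆∁X ∘ ρ)
    via-ρ : ∀ r → Sat A (rename ρ φ) (r ∪ᵥ c) ⇔ Sat A φ (project ρ r ∪ᵥ project ρ c)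
    via-ρ r = Sat-rename A ρ φ (r ∪ᵥ c) (project ρ r ∪ᵥ project ρ c) (lookup-zipWith-project _∪_ ρ r c)

  incl-determined : {a b c : Vec Sub n} → All (_⊆ X) a → All (_⊆ X) b → SameInclusions a b →
                    All (_⊆ ∁ X) c → ∀ x y → Sat A (incl x y) (a ∪ᵥ c) ⇔ Sat A (incl x y) (b ∪ᵥ c)
  incl-determined {a = a} {b} {c} a⊆X b⊆X sameIncl c⊆∁X x y = begin
    lookup (a ∪ᵥ c) x ⊆ lookup (a ∪ᵥ c) y              ≡⟨ lookups a ⟩
    lookup a x ∪ lookup c x ⊆ lookup a y ∪ lookup c y  ≈⟨ split a⊆X ⟩
    (Inclusion a (x , y) × lookup c x ⊆ lookup c y)    ≈⟨ sameIncl (x , y) ×-⇔ ⇔-refl ⟩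
    (Inclusion b (x , y) × lookup c x ⊆ lookup c y)    ≈⟨ split b⊆X ⟨
    lookup b x ∪ lookup c x ⊆ lookup b y ∪ lookup c y  ≡⟨ lookups b ⟨
    lookup (b ∪ᵥ c) x ⊆ lookup (b ∪ᵥ c) y              ∎
    where
    open ⇔-Reasoning
    lookups : ∀ r → (lookup (r ∪ᵥ c) x ⊆ lookup (r ∪ᵥ c) y)
                    ≡ (lookup r x ∪ lookup c x ⊆ lookup r y ∪ lookup c y)
    lookups r = cong₂ _⊆_ (lookup-zipWith _∪_ x r c) (lookup-zipWith _∪_ y r c)
    split : {r : Vec Sub _} → All (_⊆ X) r →
            (lookup r x ∪ lookup c x ⊆ lookup r y ∪ lookup c y)
            ⇔ (Inclusion r (x , y) × lookup c x ⊆ lookup c y)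
    split r⊆X = ∪-⊆-∪⇔ (lookup⁺ r⊆X x) (lookup⁺ r⊆X y) (lookup⁺ c⊆∁X x) (lookup⁺ c⊆∁X y)

  Agree0-intro : {a b : Vec Sub n} → All (_⊆ X) a → All (_⊆ X) b →
                 SameProjections a b → SameInclusions a b → Agree 0 a b
  Agree0-intro {a = a} {b} a⊆X b⊆X sameProj sameIncl c c⊆∁X = agree
    where
    agree : (φ : Formula S _) → qd φ ≤ 0 → Sat A φ (a ∪ᵥ c) ⇔ Sat A φ (b ∪ᵥ c)
    agree (atom i xs) _  = atom-determined {a = a} {b} sameProj c⊆∁X i xs
    agree (incl x y)  _  = incl-determined a⊆X b⊆X sameIncl c⊆∁X x y
    agree (neg φ)     q  = ¬-cong-⇔ (agree φ q)
    agree (conj φ ψ)  q  =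
      agree φ (m⊔n≤o⇒m≤o (qd φ) (qd ψ) q) ×-⇔ agree ψ (m⊔n≤o⇒n≤o (qd φ) (qd ψ) q)
    agree (ex φ)      ()

  RowEq0-cover : Cover (RowEq A X 0 M) B → ∀ l → Cover (RowEq A X 0 l) (rowBound M B l)
  RowEq0-cover cover l =
    Cover-weaken (λ {a} {b} (sameProj , sameIncl) →
                    Agree0-intro (proj₂ a) (proj₂ b) (reindexProj {proj₁ a} {proj₁ b} sameProj)
                                                       (reindexIncl {proj₁ a} {proj₁ b} sameIncl))
      (Cover-× (Cover-Π (l ^ M) λ j → Cover-comap (projectRow (finToFun j)) cover)
               (Cover-Π (l * l) λ j → Cover-⇔ λ a → Inclusion (proj₁ a) (remQuot l j)))
    where
    projectRow : (Fin M → Fin l) → Row A X l → Row A X M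
    projectRow ρ (a , a⊆X) = project ρ a , tabulate⁺ (lookup⁺ a⊆X ∘ ρ)
    reindexProj : {a b : Vec Sub l} →
                  (∀ j → Agree 0 (project (finToFun j) a) (project (finToFun j) b)) →
                  SameProjections a b
    reindexProj {a} {b} agree ρ =
      subst₂ (Agree 0) (project-cong (finToFun-funToFin ρ) a) (project-cong (finToFun-funToFin ρ) b)
             (agree (funToFin ρ))
    reindexIncl : {a b : Vec Sub l} →
                  (∀ j → Inclusion a (remQuot l j) ⇔ Inclusion b (remQuot l j)) → SameInclusions a b
    reindexIncl {a} {b} same (x , y) =
      subst (λ p → Inclusion a p ⇔ Inclusion b p) (remQuot-combine x y) (same (combine x y))

  Part : Set
  Part = Σ Sub (_⊆ X)

  infixr 5 _∷ᵣ_
  _∷ᵣ_ : Part → Row A X n → Row A X (suc n)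
  (Z , Z⊆X) ∷ᵣ (a , a⊆X) = Z ∷ a , Z⊆X ∷ a⊆X

  BackAndForth : ℕ → Row A X n → Row A X n → Set
  Forth : ℕ → Row A X n → Row A X n → Set
  BackAndForth zero    a b = RowEq A X 0 _ a b
  BackAndForth (suc k) a b = RowEq A X 0 _ a b × Forth k a b × Forth k b a
  Forth k a b = (Z : Part) → ¬ ¬ ∃ λ Z′ → BackAndForth k (Z ∷ᵣ a) (Z′ ∷ᵣ b)

  BackAndForth-sym : ∀ k {a b : Row A X n} → BackAndForth k a b → BackAndForth k b a
  BackAndForth-sym zero    agree                 = Agree-sym agree
  BackAndForth-sym (suc k) (agree , forth , back) = Agree-sym agree , back , forth

  BackAndForth⇒RowEq0 : ∀ k {a b : Row A X n} → BackAndForth k a b → RowEq A X 0 n a b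
  BackAndForth⇒RowEq0 zero    agree     = agree
  BackAndForth⇒RowEq0 (suc k) (agree , _) = agree

  Sat-transfer : ∀ k {a b : Row A X n} (φ : Formula S n) → qd φ ≤ k → BackAndForth k a b →
                 (c : Vec Sub n) → All (_⊆ ∁ X) c → Sat A φ (proj₁ a ∪ᵥ c) → Sat A φ (proj₁ b ∪ᵥ c)
  Sat-transfer k φ@(atom _ _) _ ab c c⊆∁X = Equivalence.to (BackAndForth⇒RowEq0 k ab c c⊆∁X φ z≤n)
  Sat-transfer k φ@(incl _ _) _ ab c c⊆∁X = Equivalence.to (BackAndForth⇒RowEq0 k ab c c⊆∁X φ z≤n)
  Sat-transfer k (neg φ) qd≤k ab c c⊆∁X ¬s s′ =
    ¬s (Sat-transfer k φ qd≤k (BackAndForth-sym k ab) c c⊆∁X s′)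
  Sat-transfer k (conj φ ψ) qd≤k ab c c⊆∁X (s , s′) =
    Sat-transfer k φ (m⊔n≤o⇒m≤o (qd φ) (qd ψ) qd≤k) ab c c⊆∁X s ,
    Sat-transfer k ψ (m⊔n≤o⇒n≤o (qd φ) (qd ψ) qd≤k) ab c c⊆∁X s′
  Sat-transfer (suc k) {a} {b} (ex φ) (s≤s qd≤k) (_ , forth , _) c c⊆∁X (W , s) =
    decidable-stable (Sat? A (ex φ) (proj₁ b ∪ᵥ c)) (¬¬-map answer (forth Z))
    where
    Z : Part
    Z = W ∩ X , λ x∈ → proj₂ (x∈p∩q⁻ W X x∈)
    Y = W ∩ ∁ X
    Y⊆∁X : Y ⊆ ∁ X
    Y⊆∁X x∈ = proj₂ (x∈p∩q⁻ W (∁ X) x∈)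
    s-split : Sat A φ (proj₁ (Z ∷ᵣ a) ∪ᵥ (Y ∷ c))
    s-split = subst (λ V → Sat A φ (V ∷ (proj₁ a ∪ᵥ c))) (∩-∁-split W X) s
    answer : ∃ (λ Z′ → BackAndForth k (Z ∷ᵣ a) (Z′ ∷ᵣ b)) → Sat A (ex φ) (proj₁ b ∪ᵥ c)
    answer (Z′ , ZaZ′b) = proj₁ Z′ ∪ Y , Sat-transfer k φ qd≤k ZaZ′b (Y ∷ c) (Y⊆∁X ∷ c⊆∁X) s-split

  BackAndForth⇒RowEq : ∀ k {a b : Row A X n} → BackAndForth k a b → RowEq A X k n a b
  BackAndForth⇒RowEq k ab c c⊆∁X φ qd≤k =
    mk⇔ (Sat-transfer k φ qd≤k ab c c⊆∁X) (Sat-transfer k φ qd≤k (BackAndForth-sym k ab) c c⊆∁X)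

  BackAndForth-cover : {b : ℕ → ℕ} → (∀ l → Cover (RowEq A X 0 l) (b l)) →
                       ∀ k l → Cover (BackAndForth {l} k) (towerBound b k l)
  BackAndForth-cover covers zero    l = covers l
  BackAndForth-cover {b} covers (suc k) l =
    Cover-weaken (λ (agree , sameReach) → agree , forth sameReach , forth (⇔-sym ∘ sameReach))
      (Cover-× (covers l) (Cover-Π (towerBound b k (suc l)) (Cover-⇔ ∘ Reaches)))
    where
    open Cover (BackAndForth-cover covers k (suc l))
    Reaches : Fin (towerBound b k (suc l)) → Row A X l → Set
    Reaches i a = ∃ λ Z → Class (Z ∷ᵣ a) i
    forth : {a a′ : Row A X l} → (∀ i → Reaches i a ⇔ Reaches i a′) → Forth k a a′
    forth {a} sameReach Z = ¬¬-map (λ (i , Za∈i) →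
      let (Z′ , Z′a′∈i) = Equivalence.to (sameReach i) (Z , Za∈i) in Z′ , related Za∈i Z′a′∈i)
      (classify (Z ∷ᵣ a))

  RowsAtMost⇒¬¬Covers : RowsAtMost A X 0 M B → ¬ ¬ (∀ l → Cover (RowEq A X 0 l) (rowBound M B l))
  RowsAtMost⇒¬¬Covers atMost =
    ¬¬-map RowEq0-cover (AtMostClasses⇒¬¬Cover (Agree-sym {d = 0}) (Agree-trans {d = 0}) atMost)

  RowsAtMost-arity : ∀ l → RowsAtMost A X 0 M B → RowsAtMost A X 0 l (rowBound M B l)
  RowsAtMost-arity l = ¬¬Cover⇒AtMostClasses ∘ ¬¬-map (λ covers → covers l) ∘ RowsAtMost⇒¬¬Covers

  RowsAtMost-depth : ∀ d → RowsAtMost A X 0 M B → RowsAtMost A X d M (towerBound (rowBound M B) d M)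
  RowsAtMost-depth {B} d = ¬¬Cover⇒AtMostClasses ∘ ¬¬-map depthCover ∘ RowsAtMost⇒¬¬Covers
    where
    depthCover : (∀ l → Cover (RowEq A X 0 l) (rowBound M B l)) →
                 Cover (RowEq A X d M) (towerBound (rowBound M B) d M)
    depthCover covers = Cover-weaken (BackAndForth⇒RowEq d) (BackAndForth-cover covers d M)

  RowsAtMost-dropPrefix : ∀ {d} j → RowsAtMost A X d (j + n) B → RowsAtMost A X d n B
  RowsAtMost-dropPrefix {n = n} {B} {d} j =
    AtMostClasses-reflect {R = RowEq A X d n} {S = RowEq A X d (j + n)} {B = B}
    (λ (a , a⊆X) → replicate j ∅ ++ a , ++⁺ (replicate-∅⊆ j) a⊆X)
    (Agree-dropPrefix (replicate j ∅) (replicate j ∅) (replicate-∅⊆ j))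

  RowsAtMost-depth-mono : ∀ {d d′} → d ≤ d′ → RowsAtMost A X d′ n B → RowsAtMost A X d n B
  RowsAtMost-depth-mono {n = n} {B} {d} {d′} d≤d′ =
    AtMostClasses-reflect {R = RowEq A X d n} {S = RowEq A X d′ n} {B = B} id (Agree-mono d≤d′)

module _ {S : Signature} {C : Structure S → Set} where

  Controls : (Dom C → ℕ → Set) → (Dom C → ℕ → Set) → Set
  Controls μ₁≤ μ₂≤ = ∃ λ (f : ℕ → ℕ) → ∀ x B → μ₁≤ x B → μ₂≤ x (f B)

  Controls⇒BoundedOn : {Y : Dom C → Set} {μ₁≤ μ₂≤ : Dom C → ℕ → Set} →
                       Controls μ₁≤ μ₂≤ → BoundedOn Y μ₁≤ → BoundedOn Y μ₂≤
  Controls⇒BoundedOn (f , control) (B , bounded) = f B , λ x x∈Y → control x B (bounded x x∈Y)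

  AsympEquiv-intro : {μ₁≤ μ₂≤ : Dom C → ℕ → Set} →
                     Controls μ₁≤ μ₂≤ → Controls μ₂≤ μ₁≤ → AsympEquiv C μ₁≤ μ₂≤
  AsympEquiv-intro control₁₂ control₂₁ Y =
    mk⇔ (Controls⇒BoundedOn control₁₂) (Controls⇒BoundedOn control₂₁)

  AsympEquiv-sym : {μ₁≤ μ₂≤ : Dom C → ℕ → Set} → AsympEquiv C μ₁≤ μ₂≤ → AsympEquiv C μ₂≤ μ₁≤
  AsympEquiv-sym equiv = ⇔-sym ∘ equiv

  AsympEquiv-trans : {μ₁≤ μ₂≤ μ₃≤ : Dom C → ℕ → Set} →
                     AsympEquiv C μ₁≤ μ₂≤ → AsympEquiv C μ₂≤ μ₃≤ → AsympEquiv C μ₁≤ μ₃≤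
  AsympEquiv-trans equiv₁₂ equiv₂₃ Y = ⇔-trans (equiv₁₂ Y) (equiv₂₃ Y)

  numRows-Controls : ∀ {d n d′ n′} (f : ℕ → ℕ) →
                     (∀ (A : Structure S) X {B} →
                        RowsAtMost A X d n B → RowsAtMost A X d′ n′ (f B)) →
                     Controls (numRows≤ C d n) (numRows≤ C d′ n′)
  numRows-Controls f rows = f , λ (A , _ , X) B → rows A X

lemmaA2 : (S : Signature) (C : Structure S → Set) (d : ℕ) →
    AsympEquiv C (numRows≤ C 0 (maxArity S)) (numRows≤ C 0 (d + maxArity S))
    × AsympEquiv C (numRows≤ C 0 (maxArity S)) (numRows≤ C d (maxArity S))
    × AsympEquiv C (numRows≤ C 0 (d + maxArity S)) (numRows≤ C d (maxArity S))
lemmaA2 S C d = equiv₁₂ , equiv₁₃ , AsympEquiv-trans (AsympEquiv-sym equiv₁₂) equiv₁₃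
  where
  M = maxArity S
  equiv₁₂ : AsympEquiv C (numRows≤ C 0 M) (numRows≤ C 0 (d + M))
  equiv₁₂ = AsympEquiv-intro
    (numRows-Controls (λ B → rowBound M B (d + M)) λ A X → RowsAtMost-arity A X (d + M))
    (numRows-Controls id λ A X → RowsAtMost-dropPrefix A X d)
  equiv₁₃ : AsympEquiv C (numRows≤ C 0 M) (numRows≤ C d M)
  equiv₁₃ = AsympEquiv-intro
    (numRows-Controls (λ B → towerBound (rowBound M B) d M) λ A X → RowsAtMost-depth A X d)
    (numRows-Controls id λ A X → RowsAtMost-depth-mono A X z≤n)
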